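{- Let $r\ge 2$ be even, $k\ge 1$, and $H$ an $r$-uniform cgh on $\Omega_n$. For $\mathbf v_k=(v_{k-1},v_k,\dots,v_{k+r-2})\in T_k(H)$, the map $g(\mathbf v_k)=(v_k,v_{k+1},\dots,v_{k+r-2})$ is an injection from $T_k(H)$ to cyclically ordered elements of $\partial H$. In particular, $|T_k(H)|\le (r-1)|\partial H|$.
   Context: $\Omega_n$ is a set of $n$ points in strictly convex position in the plane with cyclic (clockwise) ordering $\prec$; for $u,v\in\Omega_n$, $[u,v]$ is the set of points met going clockwise from $u$ to $v$, including $u$ and $v$. An $r$-uniform cgh on $\Omega_n$ is a set $H$ of $r$-subsets of $\Omega_n$; its shadow is $\partial H=\{e\setminus\{x\}: x\in e\in H\}$. Segments of $\Omega_n$ are sets of cyclically consecutive points, each linearly ordered clockwise; disjoint segments satisfy $I_0 \prec \dots \prec I_{r-1}$ if they appear in this order going once around clockwise. For even $r$, a $k$-zigzag in $H$ is a sequence of distinct points $v_0,\dots,v_{k+r-2}$ with $\{v_i,\dots,v_{i+r-1}\}\in H$ for $0\le i<k$, for which there are disjoint segments $I_0 \prec \dots \prec I_{r-1}$ with $\{v_i : i\equiv j \pmod r\}\subseteq I_j$, such that for even $j$: $v_j \prec v_{j+r} \prec \cdots$ in $I_j$, and for odd $j$: $v_j \succ v_{j+r}\succ \cdots$ in $I_j$. The end of the $k$-zigzag is $\mathbf v_k=(v_{k-1},v_k,\dots,v_{k+r-2})$; $S_k(H)$ is the set of ends of $k$-zigzags in $H$. For $\mathbf v_k\in S_k(H)$,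 $I(\mathbf v_k)=[v_{k-1},v_k]$ if $k$ is odd and $I(\mathbf v_k)=[v_{k+r-2},v_{k-1}]$ if $k$ is even, $X(\mathbf v_k)=\{v\in I(\mathbf v_k)\setminus\{v_{k-1}\} : \{v,v_k,\dots,v_{k+r-2}\}\in H\}$, and $T_k(H)=\{\mathbf v_k\in S_k(H): X(\mathbf v_k)=\emptyset\}$. A cyclically ordered element of $\partial H$ is an $(r-1)$-set in $\partial H$ together with one of its $r-1$ cyclic orderings (rotations of its order along $\prec$). -}

module Defs where

open import Data.Nat using (ℕ; zero; suc; _+_; _*_; _∸_; _≤_; _<_; _>_; _≤ᵇ_)
open import Data.Nat.Divisibility using (_∣_)
open import Data.Bool using (if_then_else_)
open import Data.Fin using (Fin; toℕ)
open import Data.Fin.Subset using (Subset; ⁅_⁆; _∪_; _-_; ∣_∣) renaming (⊥ to ∅ˢ; _∈_ to _∈ˢ_)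
open import Data.List using (List; []; _∷_; map; drop; upTo; length)
open import Data.List.Membership.Propositional using (_∈_)
open import Data.List.Relation.Unary.Unique.Propositional using (Unique)
open import Data.List.Relation.Unary.Linked using (Linked)
open import Data.Product using (Σ; ∃; _×_)
open import Relation.Binary.PropositionalEquality using (_≡_; _≢_)
open import Relation.Nullary using (¬_)
open import Data.Unit using (⊤)

-- Ω_n is modelled by Fin n; the clockwise cyclic order is increasing index mod n.

CGH : ℕ → Set₁
CGH n = Subset n → Set

Uniform : ∀ {n} → ℕ → CGH n → Set
Uniform r H = ∀ e → H e → ∣ e ∣ ≡ r

off : ∀ {n} → Fin n → Fin n → ℕ
off {n} a x = if toℕ a ≤ᵇ toℕ x then toℕ x ∸ toℕ a else (n + toℕ x) ∸ toℕ a

-- x ∈ [u , v] : x is met going clockwise from u to v (inclusive)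
InCyc : ∀ {n} → Fin n → Fin n → Fin n → Set
InCyc u v x = off u x ≤ off u v

block : ∀ {n} → (ℕ → Fin n) → ℕ → ℕ → Subset n
block v i zero = ∅ˢ
block v i (suc m) = ⁅ v i ⁆ ∪ block v (suc i) m

setOf : ∀ {n} → List (Fin n) → Subset n
setOf [] = ∅ˢ
setOf (x ∷ xs) = ⁅ x ⁆ ∪ setOf xs

Shadow : ∀ {n} → CGH n → Subset n → Set
Shadow H s = Σ _ λ e → H e × Σ _ λ x → x ∈ˢ e × s ≡ e - x

-- Disjoint segments I_0 ≺ … ≺ I_{r-1} going once around clockwise are
-- I_j = { x : α j ≤ off a x ≤ β j } with
-- α 0 ≤ β 0 < α 1 ≤ β 1 < … < α (r-1) ≤ β (r-1) < n, for a base point a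
-- (the first point of I_0); the linear (clockwise) order inside I_j is the
-- order of off a.
-- k-zigzag in H (r even), given by v : ℕ → Fin n, of which only
-- v 0 , … , v (k+r-2) matter.
record Zigzag {n} (r k : ℕ) (H : CGH n) (v : ℕ → Fin n) : Set where
  field
    distinct : ∀ i i' → i < k + r ∸ 1 → i' < k + r ∸ 1 → v i ≡ v i' → i ≡ i'
    edges    : ∀ i → i < k → H (block v i r)
    a        : Fin n
    α β      : ℕ → ℕ
    αβ       : ∀ j → j < r → α j ≤ β j
    βα       : ∀ j → suc j < r → β j < α (suc j)
    βn       : β (r ∸ 1) < n
    inSeg    : ∀ j m → j < r → j + m * r < k + r ∸ 1 →
                 α j ≤ off a (v (j + m * r)) × off a (v (j + m * r)) ≤ β j
    evenInc  : ∀ j m → j < r → j + suc m * r < k + r ∸ 1 → 2 ∣ j →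
                 off a (v (j + m * r)) < off a (v (j + suc m * r))
    oddDec   : ∀ j m → j < r → j + suc m * r < k + r ∸ 1 → ¬ (2 ∣ j) →
                 off a (v (j + m * r)) > off a (v (j + suc m * r))

end : ∀ {n} → ℕ → ℕ → (ℕ → Fin n) → List (Fin n)
end r k v = map (λ t → v (k ∸ 1 + t)) (upTo r)

S : ∀ {n} → ℕ → ℕ → CGH n → List (Fin n) → Set
S r k H w = ∃ λ v → Zigzag r k H v × end r k v ≡ w

InI : ∀ {n} → ℕ → ℕ → (ℕ → Fin n) → Fin n → Set
InI r k v x = (¬ (2 ∣ k) → InCyc (v (k ∸ 1)) (v k) x)
            × (2 ∣ k → InCyc (v (k + r ∸ 2)) (v (k ∸ 1)) x)

XEmpty : ∀ {n} → ℕ → ℕ → CGH n → (ℕ → Fin n) → Set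
XEmpty r k H v = ∀ x → InI r k v x → x ≢ v (k ∸ 1) → ¬ H (⁅ x ⁆ ∪ block v k (r ∸ 1))

-- T_k(H) (X depends only on the end v_k, which is w)
T : ∀ {n} → ℕ → ℕ → CGH n → List (Fin n) → Set
T r k H w = ∃ λ v → Zigzag r k H v × end r k v ≡ w × XEmpty r k H v

g : ∀ {n} → List (Fin n) → List (Fin n)
g w = drop 1 w

-- a list (u_1,…,u_m) is a rotation of the clockwise order of its entries:
-- going clockwise from u_1 one meets u_2, …, u_m in this order (all distinct)
CycOrd : ∀ {n} → List (Fin n) → Set
CycOrd [] = ⊤
CycOrd (a ∷ us) = Linked _<_ (map (off a) (a ∷ us))

CycShadow : ∀ {n} → CGH n → List (Fin n) → Set
CycShadow H u = Shadow H (setOf u) × CycOrd u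

-- L lists the elements of P, each exactly once (so length L = |P|)
Enumerates : ∀ {A : Set} → (A → Set) → List A → Set
Enumerates P L = Unique L × (∀ x → x ∈ L → P x) × (∀ x → P x → x ∈ L)

module Submission where

-- 1. Clockwise offsets.  off a x is the clockwise distance from a to x; the
--    basic fact is the triangle law off a b + off b c ∈ {off a c, off a c + n},
--    from which we derive how orders seen from a and from b compare.
-- 2. The end of a zigzag.  Its last r−1 points v_k, …, v_{k+r−2} have r−1
--    consecutive indices, so they lie in r−1 distinct segments, visited in
--    cyclic order starting from the segment of v_k; hence, seen from v_k, they
--    are strictly increasing, and deleting v_{k−1} from the last edge shows
--    that they form a shadow.  If two ends in T_k(H) have the same image but different
--    first points p, p′, then one of p, p′ lies in the interval I of the other
--    end and spans an edge with the common tail, contradicting X = ∅.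
-- 4. Counting.  A cyclically ordered list is determined by its first point
--    and its point set, so w ↦ (first point, point set) of g w is injective on
--    T_k(H) with values among the pairs (x , s), x ∈ s ∈ ∂H; there are at most
--    (r−1)|∂H| such pairs, and a pigeonhole argument finishes part 3.

open import Defs
open import Data.Nat using (ℕ; zero; suc; _+_; _*_; _∸_; _≤_; _<_; _≤ᵇ_; _<?_; z≤n; s≤s)
open import Data.Nat.Divisibility using (_∣_; _∣?_)
open import Data.Nat.DivMod using (_%_; _/_; m≡m%n+[m/n]*n; m%n<n)
open import Data.Nat.Properties hiding (_≟_)
open import Data.Nat.Tactic.RingSolver using (solve-∀)
open import Data.Bool using (true; false) renaming (T to IsTrue)
open import Data.Unit using (tt)
open import Data.Fin using (Fin; toℕ; zero; suc; _≟_)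
open import Data.Fin.Subset using (Subset; ⁅_⁆; _∪_; _─_; _-_; ∣_∣; inside; outside)
  renaming (⊥ to ∅; _∈_ to _∈ˢ_; _∉_ to _∉ˢ_)
open import Data.Fin.Subset.Properties using (x∈p⇒∣p-x∣<∣p∣; x∈p∪q⁺; x∈p∪q⁻; x∈⁅x⁆; x∈⁅y⁆⇒x≡y; ∉⊥; ∪-identityˡ; p─⊥≡p)
open import Data.Vec using ([]; _∷_)
import Data.Vec.Base as Vec
open import Data.List using (List; []; _∷_; _++_; map; applyUpTo; length; head)
open import Data.List.Properties using (map-upTo; length-map; length-++; map-injective; length-removeAt′; ∷-injectiveˡ; ∷-injectiveʳ)
open import Data.List.Membership.Propositional using (_∈_)
open import Data.List.Membership.Propositional.Properties using (∈-map⁺; ∈-map⁻; ∈-applyUpTo⁻; ∈-++⁺ˡ; ∈-++⁺ʳ)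
open import Data.List.Relation.Unary.Any using (here; there)
open import Data.List.Relation.Unary.All using (All) renaming (lookup to All-lookup)
open import Data.List.Relation.Unary.AllPairs using (AllPairs; _∷_)
import Data.List.Relation.Unary.Any as Any
open import Data.List.Relation.Unary.Unique.Propositional using (Unique)
open import Data.List.Relation.Unary.Linked.Properties using (Linked⇒AllPairs; applyUpTo⁺₁) renaming (map⁺ to Linked-map⁺)
open import Data.Maybe using (Maybe; just)
open import Data.Maybe.Properties using (just-injective)
open import Data.Fin.Properties using (toℕ<n; toℕ-injective)
open import Data.Product using (∃; _×_; _,_; proj₁; proj₂)
open import Data.Sum using (_⊎_; inj₁; inj₂)
open import Data.Empty using (⊥-elim)
open import Relation.Nullary using (¬_; yes; no)
open import Relation.Binary.PropositionalEquality
open import Function using (_∘_)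

module _ {n : ℕ} where

  data Wrap (a x : Fin n) : ℕ → Set where
    forward : toℕ a ≤ toℕ x → Wrap a x 0
    wrapped : toℕ x < toℕ a → Wrap a x n

  offView : ∀ a x → ∃ λ w → Wrap a x w × off a x + toℕ a ≡ toℕ x + w
  offView a x with toℕ a ≤ᵇ toℕ x in eq
  ... | true  = 0 , forward a≤x , trans (m∸n+n≡m a≤x) (sym (+-identityʳ (toℕ x)))
    where
    a≤x : toℕ a ≤ toℕ x
    a≤x = ≤ᵇ⇒≤ (toℕ a) (toℕ x) (subst IsTrue (sym eq) tt)
  ... | false = n , wrapped x<a , trans (m∸n+n≡m a≤n+x) (+-comm n (toℕ x))
    where
    x<a : toℕ x < toℕ a
    x<a = ≰⇒> λ a≤x → subst IsTrue eq (≤⇒≤ᵇ a≤x)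
    a≤n+x : toℕ a ≤ n + toℕ x
    a≤n+x = ≤-trans (<⇒≤ (toℕ<n a)) (m≤m+n n (toℕ x))

  off<n : ∀ a x → off a x < n
  off<n a x with offView a x
  ... | _ , forward _ , e = ≤-<-trans (m+n≤o⇒m≤o (off a x) (≤-reflexive (trans e (+-identityʳ _)))) (toℕ<n x)
  ... | _ , wrapped x<a , e = +-cancelʳ-< (toℕ a) (off a x) n (begin-strict
    off a x + toℕ a ≡⟨ e ⟩
    toℕ x + n       <⟨ +-monoˡ-< n x<a ⟩
    toℕ a + n       ≡⟨ +-comm (toℕ a) n ⟩
    n + toℕ a       ∎)
    where open ≤-Reasoning

  off-self : ∀ a → off a a ≡ 0
  off-self a with offView a a
  ... | _ , forward _ , e = +-cancelʳ-≡ (toℕ a) (off a a) 0 (trans e (+-identityʳ (toℕ a)))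
  ... | _ , wrapped a<a , _ = ⊥-elim (<-irrefl refl a<a)

  off≡0⇒≡ : ∀ a x → off a x ≡ 0 → a ≡ x
  off≡0⇒≡ a x z with offView a x
  ... | _ , forward _ , e = toℕ-injective (trans (sym (cong (_+ toℕ a) z)) (trans e (+-identityʳ (toℕ x))))
  ... | _ , wrapped _ , e = ⊥-elim (<⇒≱ (toℕ<n a) (begin
    n               ≤⟨ m≤n+m n (toℕ x) ⟩
    toℕ x + n       ≡⟨ sym e ⟩
    off a x + toℕ a ≡⟨ cong (_+ toℕ a) z ⟩
    toℕ a           ∎))
    where open ≤-Reasoning

  private
    -- Adding the defining equations of off a b and off b c and comparing
    -- with that of off a c, the base points cancel.
    wraps-balance : ∀ ab bc ac {A B C w₁ w₂ w₃} →
      ab + A ≡ B + w₁ → bc + B ≡ C + w₂ → ac + A ≡ C + w₃ →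
      ab + bc + w₃ ≡ ac + (w₁ + w₂)
    wraps-balance ab bc ac {A} {B} {C} {w₁} {w₂} {w₃} e₁ e₂ e₃ =
      +-cancelʳ-≡ (A + B) _ _ (begin
        ab + bc + w₃ + (A + B)     ≡⟨ regroup₁ ab bc w₃ A B ⟩
        (ab + A) + (bc + B) + w₃   ≡⟨ cong₂ (λ x y → x + y + w₃) e₁ e₂ ⟩
        (B + w₁) + (C + w₂) + w₃   ≡⟨ regroup₂ B w₁ C w₂ w₃ ⟩
        (C + w₃) + (w₁ + w₂) + B   ≡⟨ cong (λ x → x + (w₁ + w₂) + B) (sym e₃) ⟩
        (ac + A) + (w₁ + w₂) + B   ≡⟨ regroup₃ ac A w₁ w₂ B ⟩
        ac + (w₁ + w₂) + (A + B)   ∎)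
      where
      open ≡-Reasoning
      regroup₁ : ∀ ab bc w A B → ab + bc + w + (A + B) ≡ (ab + A) + (bc + B) + w
      regroup₁ = solve-∀
      regroup₂ : ∀ B w₁ C w₂ w₃ → (B + w₁) + (C + w₂) + w₃ ≡ (C + w₃) + (w₁ + w₂) + B
      regroup₂ = solve-∀
      regroup₃ : ∀ ac A w₁ w₂ B → (ac + A) + (w₁ + w₂) + B ≡ ac + (w₁ + w₂) + (A + B)
      regroup₃ = solve-∀

  off-triangle : ∀ a b c →
    (off a b + off b c ≡ off a c) ⊎ (off a b + off b c ≡ off a c + n)
  off-triangle a b c with offView a b | offView b c | offView a c
  ... | _ , v₁ , e₁ | _ , v₂ , e₂ | _ , v₃ , e₃ = close v₁ v₂ v₃ (wraps-balance (off a b) (off b c) (off a c) e₁ e₂ e₃)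
    where
    s t : ℕ
    s = off a b + off b c
    t = off a c
    close : ∀ {w₁ w₂ w₃} → Wrap a b w₁ → Wrap b c w₂ → Wrap a c w₃ →
            s + w₃ ≡ t + (w₁ + w₂) → (s ≡ t) ⊎ (s ≡ t + n)
    close (forward _)   (forward _)   (forward _)   e = inj₁ (+-cancelʳ-≡ 0 s t e)
    close (forward a≤b) (forward b≤c) (wrapped c<a) e = ⊥-elim (<⇒≱ c<a (≤-trans a≤b b≤c))
    close (forward _)   (wrapped _)   (forward _)   e = inj₂ (trans (sym (+-identityʳ s)) e)
    close (forward _)   (wrapped _)   (wrapped _)   e = inj₁ (+-cancelʳ-≡ n s t e)
    close (wrapped _)   (forward _)   (forward _)   e =
      inj₂ (trans (sym (+-identityʳ s)) (trans e (cong (t +_) (+-identityʳ n))))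
    close (wrapped _)   (forward _)   (wrapped _)   e =
      inj₁ (+-cancelʳ-≡ n s t (trans e (cong (t +_) (+-identityʳ n))))
    close (wrapped b<a) (wrapped c<b) (forward a≤c) e = ⊥-elim (<⇒≱ (<-trans c<b b<a) a≤c)
    close (wrapped _)   (wrapped _)   (wrapped _)   e =
      inj₂ (+-cancelʳ-≡ n s (t + n) (trans e (sym (+-assoc t n n))))

  off-via-≤ : ∀ a b x → off a b ≤ off a x → off a b + off b x ≡ off a x
  off-via-≤ a b x b≤x with off-triangle a b x
  ... | inj₁ e = e
  ... | inj₂ e = ⊥-elim (<⇒≱ (off<n b x) (+-cancelˡ-≤ (off a b) n (off b x) (begin
    off a b + n ≤⟨ +-monoˡ-≤ n b≤x ⟩
    off a x + n ≡⟨ sym e ⟩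
    off a b + off b x ∎)))
    where open ≤-Reasoning

  off-via-> : ∀ a b x → off a x < off a b → off a b + off b x ≡ off a x + n
  off-via-> a b x x<b with off-triangle a b x
  ... | inj₁ e = ⊥-elim (<⇒≱ x<b (subst (off a b ≤_) e (m≤m+n (off a b) (off b x))))
  ... | inj₂ e = e

  off-injective : ∀ a x y → off a x ≡ off a y → x ≡ y
  off-injective a x y e = off≡0⇒≡ x y (+-cancelˡ-≡ (off a x) (off x y) 0 (begin
    off a x + off x y ≡⟨ off-via-≤ a x y (≤-reflexive e) ⟩
    off a y           ≡⟨ sym e ⟩
    off a x           ≡⟨ sym (+-identityʳ (off a x)) ⟩
    off a x + 0       ∎))
    where open ≡-Reasoning

  arc-dichotomy : ∀ p p′ c → p ≢ p′ → InCyc p c p′ ⊎ InCyc p′ c p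
  arc-dichotomy p p′ c p≢p′ with off p p′ ≤? off p c
  ... | yes p′≤c = inj₁ p′≤c
  ... | no  p′≰c = inj₂ (+-cancelˡ-≤ (off p p′) (off p′ p) (off p′ c) (begin
    off p p′ + off p′ p ≡⟨ off-via-> p p′ p p≺p′ ⟩
    off p p + n         ≡⟨ cong (_+ n) (off-self p) ⟩
    n                   ≤⟨ m≤n+m n (off p c) ⟩
    off p c + n         ≡⟨ sym (off-via-> p p′ c (≰⇒> p′≰c)) ⟩
    off p p′ + off p′ c ∎))
    where
    open ≤-Reasoning
    p≺p′ : off p p < off p p′
    p≺p′ = subst (_< off p p′) (sym (off-self p)) (n≢0⇒n>0 (p≢p′ ∘ off≡0⇒≡ p p′))

  rebase-after : ∀ a b x y → off a b ≤ off a x → off a x < off a y → off b x < off b y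
  rebase-after a b x y b≤x x<y = +-cancelˡ-< (off a b) (off b x) (off b y) (subst₂ _<_
    (sym (off-via-≤ a b x b≤x)) (sym (off-via-≤ a b y (≤-trans b≤x (<⇒≤ x<y)))) x<y)

  rebase-before : ∀ a b x y → off a x < off a y → off a y < off a b → off b x < off b y
  rebase-before a b x y x<y y<b = +-cancelˡ-< (off a b) (off b x) (off b y) (subst₂ _<_
    (sym (off-via-> a b x (<-trans x<y y<b))) (sym (off-via-> a b y y<b)) (+-monoˡ-< n x<y))

  rebase-across : ∀ a b x y → off a b ≤ off a x → off a y < off a b → off b x < off b y
  rebase-across a b x y b≤x y<b = +-cancelˡ-< (off a b) (off b x) (off b y) (subst₂ _<_
    (sym (off-via-≤ a b x b≤x)) (sym (off-via-> a b y y<b)) (<-≤-trans (off<n a x) (m≤n+m n (off a y))))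

applyUpTo-cong : ∀ {A : Set} {f g : ℕ → A} m → (∀ t → f t ≡ g t) → applyUpTo f m ≡ applyUpTo g m
applyUpTo-cong zero    f≗g = refl
applyUpTo-cong (suc m) f≗g = cong₂ _∷_ (f≗g 0) (applyUpTo-cong m (f≗g ∘ suc))

applyUpTo-injective : ∀ {A : Set} {f g : ℕ → A} m → applyUpTo f m ≡ applyUpTo g m →
                      ∀ t → t < m → f t ≡ g t
applyUpTo-injective (suc m) e zero    _         = ∷-injectiveˡ e
applyUpTo-injective (suc m) e (suc t) (s≤s t<m) = applyUpTo-injective m (∷-injectiveʳ e) t t<m

module _ {n : ℕ} where

  setOf⁺ : ∀ {x : Fin n} xs → x ∈ xs → x ∈ˢ setOf xs
  setOf⁺ (y ∷ xs) (here refl) = x∈p∪q⁺ (inj₁ (x∈⁅x⁆ y))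
  setOf⁺ (y ∷ xs) (there x∈xs) = x∈p∪q⁺ (inj₂ (setOf⁺ xs x∈xs))

  setOf⁻ : ∀ {x : Fin n} xs → x ∈ˢ setOf xs → x ∈ xs
  setOf⁻ []       x∈∅ = ⊥-elim (∉⊥ x∈∅)
  setOf⁻ (y ∷ xs) x∈s with x∈p∪q⁻ ⁅ y ⁆ (setOf xs) x∈s
  ... | inj₁ x∈y  = here (x∈⁅y⁆⇒x≡y y x∈y)
  ... | inj₂ x∈xs = there (setOf⁻ xs x∈xs)

  setOf-block : ∀ (h : ℕ → Fin n) i m → setOf (applyUpTo (λ t → h (i + t)) m) ≡ block h i m
  setOf-block h i zero    = refl
  setOf-block h i (suc m) = cong₂ _∪_ (cong (λ j → ⁅ h j ⁆) (+-identityʳ i)) (begin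
    setOf (applyUpTo (λ t → h (i + suc t)) m) ≡⟨ cong setOf (applyUpTo-cong m (cong h ∘ +-suc i)) ⟩
    setOf (applyUpTo (λ t → h (suc i + t)) m) ≡⟨ setOf-block h (suc i) m ⟩
    block h (suc i) m                         ∎)
    where open ≡-Reasoning

insert-remove : ∀ {n} (y : Fin n) B → y ∉ˢ B → (⁅ y ⁆ ∪ B) - y ≡ B
insert-remove zero    (outside ∷ B) _   = cong (outside ∷_) (trans (cong (_─ ∅) (∪-identityˡ B)) (p─⊥≡p B))
insert-remove zero    (inside ∷ B)  y∉B = ⊥-elim (y∉B Vec.here)
insert-remove (suc y) (b ∷ B)       y∉B = cong (b ∷_) (insert-remove y B (y∉B ∘ Vec.there))

increasing-unique : ∀ {xs ys : List ℕ} → AllPairs _<_ xs → AllPairs _<_ ys →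
  (∀ {z} → z ∈ xs → z ∈ ys) → (∀ {z} → z ∈ ys → z ∈ xs) → xs ≡ ys
increasing-unique {[]}     {[]}     _ _ _ _ = refl
increasing-unique {[]}     {y ∷ ys} _ _ _ ys⊆xs with () ← ys⊆xs (here refl)
increasing-unique {x ∷ xs} {[]}     _ _ xs⊆ys _ with () ← xs⊆ys (here refl)
increasing-unique {x ∷ xs} {y ∷ ys} (x<xs ∷ xs↑) (y<ys ∷ ys↑) xs⊆ys ys⊆xs =
  cong₂ _∷_ x≡y (increasing-unique xs↑ ys↑ (tail-⊆ x<xs x≡y xs⊆ys) (tail-⊆ y<ys (sym x≡y) ys⊆xs))
  where
  x≡y : x ≡ y
  x≡y with xs⊆ys (here refl) | ys⊆xs (here refl)
  ... | here x≡y   | _          = x≡y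
  ... | _          | here y≡x   = sym y≡x
  ... | there x∈ys | there y∈xs = ⊥-elim (<-asym (All-lookup x<xs y∈xs) (All-lookup y<ys x∈ys))
  tail-⊆ : ∀ {a b as bs} → All (a <_) as → a ≡ b →
           (∀ {z} → z ∈ a ∷ as → z ∈ b ∷ bs) → ∀ {z} → z ∈ as → z ∈ bs
  tail-⊆ a<as a≡b as⊆bs z∈as with as⊆bs (there z∈as)
  ... | here refl = ⊥-elim (<-irrefl a≡b (All-lookup a<as z∈as))
  ... | there z∈bs = z∈bs

-- A cyclically ordered list is determined by its first entry and its set
-- of entries: seen from the first entry, it is strictly increasing.
cycOrd-unique : ∀ {n} (u u′ : List (Fin n)) → CycOrd u → CycOrd u′ →
                head u ≡ head u′ → setOf u ≡ setOf u′ → u ≡ u′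
cycOrd-unique []      []        _ _  _  _ = refl
cycOrd-unique (x ∷ u) (x′ ∷ u′) u↻ u′↻ x≡x′ u≈u′ with just-injective x≡x′
... | refl = map-injective (off-injective x _ _)
  (increasing-unique (Linked⇒AllPairs <-trans u↻) (Linked⇒AllPairs <-trans u′↻)
    (seen-from-x (x ∷ u) (x ∷ u′) u≈u′) (seen-from-x (x ∷ u′) (x ∷ u) (sym u≈u′)))
  where
  seen-from-x : ∀ v v′ → setOf v ≡ setOf v′ → ∀ {z} → z ∈ map (off x) v → z ∈ map (off x) v′
  seen-from-x v v′ v≈v′ z∈v with ∈-map⁻ (off x) z∈v
  ... | y , y∈v , refl = ∈-map⁺ (off x) (setOf⁻ v′ (subst (y ∈ˢ_) v≈v′ (setOf⁺ v y∈v)))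

module ZigzagEnd {n q k′ : ℕ} {H : CGH n} {v : ℕ → Fin n} (Z : Zigzag (suc (suc q)) (suc k′) H v) where
  open Zigzag Z

  r k : ℕ
  r = suc (suc q)
  k = suc k′

  rest : List (Fin n)
  rest = applyUpTo (λ t → v (k + t)) (suc q)

  end-split : end r k v ≡ v k′ ∷ rest
  end-split = trans (map-upTo (λ t → v (k′ + t)) r)
    (cong₂ _∷_ (cong v (+-identityʳ k′)) (applyUpTo-cong (suc q) (cong v ∘ +-suc k′)))

  InSeg : ℕ → Fin n → Set
  InSeg j x = α j ≤ off a x × off a x ≤ β j

  segment-gap : ∀ {j j′} → j < j′ → j′ < r → β j < α j′
  segment-gap {j} {suc j′} j<1+j′ 1+j′<r with m<1+n⇒m<n∨m≡n j<1+j′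
  ... | inj₂ refl = βα j 1+j′<r
  ... | inj₁ j<j′ = <-trans (<-≤-trans (segment-gap j<j′ j′<r) (αβ j′ j′<r)) (βα j′ 1+j′<r)
    where
    j′<r : j′ < r
    j′<r = <-trans (n<1+n j′) 1+j′<r

  segments-ordered : ∀ {j j′ x y} → j < j′ → j′ < r → InSeg j x → InSeg j′ y → off a x < off a y
  segments-ordered j<j′ j′<r (_ , x≤βj) (αj′≤y , _) = ≤-<-trans x≤βj (<-≤-trans (segment-gap j<j′ j′<r) αj′≤y)

  in-segment : ∀ {i} j m → i ≡ j + m * r → j < r → i < k + r ∸ 1 → InSeg j (v i)
  in-segment j m refl j<r i<len = inSeg j m j<r i<len

  in-window : ∀ {t} → t ≤ q → k + t < k + r ∸ 1
  in-window {t} t≤q = subst (k + t <_) (sym (+-suc k′ (suc q))) (s≤s (+-monoʳ-< k′ (s≤s t≤q)))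

  -- v_k lies in the segment I_{j₀}, j₀ = k mod r; going along the window,
  -- v_{k+t} lies in I_{j₀+t} until the index passes r and wraps to 0.
  j₀ m₀ : ℕ
  j₀ = k % r
  m₀ = k / r

  j₀<r : j₀ < r
  j₀<r = m%n<n k r

  data Lap (t : ℕ) : Set where
    first  : j₀ + t < r → Lap t
    second : ∀ e → j₀ + t ≡ r + e → Lap t

  lap : ∀ t → Lap t
  lap t with j₀ + t <? r
  ... | yes j₀+t<r = first j₀+t<r
  ... | no  j₀+t≮r = second (j₀ + t ∸ r) (sym (m+[n∸m]≡n (≮⇒≥ j₀+t≮r)))

  private
    window<r : ∀ {t} → t ≤ q → t < r
    window<r t≤q = ≤-trans (s≤s t≤q) (n≤1+n (suc q))

    k≡ : k ≡ j₀ + m₀ * r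
    k≡ = m≡m%n+[m/n]*n k r

    shift : ∀ j m R t → (j + m * R) + t ≡ (j + t) + m * R
    shift = solve-∀

    wrap : ∀ j m R t e → j + t ≡ R + e → (j + m * R) + t ≡ e + suc m * R
    wrap j m R t e j+t≡R+e = trans (shift j m R t)
      (trans (cong (_+ m * R) j+t≡R+e) (regroup R e (m * R)))
      where
      regroup : ∀ R e x → R + e + x ≡ e + (R + x)
      regroup = solve-∀

  in-first-lap : ∀ {t} → t ≤ q → j₀ + t < r → InSeg (j₀ + t) (v (k + t))
  in-first-lap {t} t≤q j₀+t<r =
    in-segment (j₀ + t) m₀ (trans (cong (_+ t) k≡) (shift j₀ m₀ r t)) j₀+t<r (in-window t≤q)

  second-lap-before : ∀ {t e} → t < r → j₀ + t ≡ r + e → e < j₀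
  second-lap-before {t} {e} t<r j₀+t≡r+e = +-cancelˡ-< r e j₀ (begin-strict
    r + e  ≡⟨ sym j₀+t≡r+e ⟩
    j₀ + t <⟨ +-monoʳ-< j₀ t<r ⟩
    j₀ + r ≡⟨ +-comm j₀ r ⟩
    r + j₀ ∎)
    where open ≤-Reasoning

  in-second-lap : ∀ {t e} → t ≤ q → j₀ + t ≡ r + e → InSeg e (v (k + t))
  in-second-lap {t} {e} t≤q j₀+t≡r+e =
    in-segment e (suc m₀) (trans (cong (_+ t) k≡) (wrap j₀ m₀ r t e j₀+t≡r+e))
      (<-trans (second-lap-before (window<r t≤q) j₀+t≡r+e) j₀<r) (in-window t≤q)

  b : Fin n
  b = v (k + 0)

  private
    j₀+0<r : j₀ + 0 < r
    j₀+0<r = subst (_< r) (sym (+-identityʳ j₀)) j₀<r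

  first-lap-after-base : ∀ {t} → t ≤ q → j₀ + t < r → off a b ≤ off a (v (k + t))
  first-lap-after-base {zero}  _   _       = ≤-refl
  first-lap-after-base {suc t} t≤q j₀+t<r = <⇒≤ (segments-ordered (+-monoʳ-< j₀ (s≤s z≤n)) j₀+t<r
    (in-first-lap z≤n j₀+0<r) (in-first-lap t≤q j₀+t<r))

  second-lap-before-base : ∀ {t e} → t ≤ q → j₀ + t ≡ r + e → off a (v (k + t)) < off a b
  second-lap-before-base {t} {e} t≤q j₀+t≡r+e = segments-ordered
    (subst (e <_) (sym (+-identityʳ j₀)) (second-lap-before (window<r t≤q) j₀+t≡r+e))
    j₀+0<r (in-second-lap t≤q j₀+t≡r+e) (in-first-lap z≤n j₀+0<r)

  -- Seen from b = v_k, consecutive points of the window move clockwise: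
  -- within a lap by the order of segments, and across the wrap because the
  -- second lap lies before b.
  window-step : ∀ {t} → suc t ≤ q → off b (v (k + t)) < off b (v (k + suc t))
  window-step {t} 1+t≤q with lap t | lap (suc t)
  ... | first l | first l′ = rebase-after a b _ _ (first-lap-after-base t≤q l)
    (segments-ordered (+-monoʳ-< j₀ (n<1+n t)) l′ (in-first-lap t≤q l) (in-first-lap 1+t≤q l′))
    where
    t≤q : t ≤ q
    t≤q = <⇒≤ 1+t≤q
  ... | first l | second _ e′≡ = rebase-across a b _ _ (first-lap-after-base (<⇒≤ 1+t≤q) l)
    (second-lap-before-base 1+t≤q e′≡)
  ... | second e e≡ | first l′ = ⊥-elim (<-irrefl refl (begin-strict
    r          ≤⟨ m≤m+n r e ⟩
    r + e      ≡⟨ sym e≡ ⟩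
    j₀ + t     <⟨ +-monoʳ-< j₀ (n<1+n t) ⟩
    j₀ + suc t <⟨ l′ ⟩
    r          ∎))
    where open ≤-Reasoning
  ... | second e e≡ | second e′ e′≡ = rebase-before a b _ _
    (segments-ordered e<e′ (<-trans (second-lap-before (window<r 1+t≤q) e′≡) j₀<r)
      (in-second-lap (<⇒≤ 1+t≤q) e≡) (in-second-lap 1+t≤q e′≡))
    (second-lap-before-base 1+t≤q e′≡)
    where
    open ≤-Reasoning
    e<e′ : e < e′
    e<e′ = +-cancelˡ-< r e e′ (begin-strict
      r + e      ≡⟨ sym e≡ ⟩
      j₀ + t     <⟨ +-monoʳ-< j₀ (n<1+n t) ⟩
      j₀ + suc t ≡⟨ e′≡ ⟩
      r + e′     ∎)

  rest-cycOrd : CycOrd rest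
  rest-cycOrd = Linked-map⁺ (applyUpTo⁺₁ (λ t → v (k + t)) (suc q) (λ {t} 1+t<1+q → window-step (≤-pred 1+t<1+q)))

  -- The edge {v_{k−1}, …, v_{k+r−2}} minus v_{k−1} shows rest ∈ ∂H.
  rest-shadow : Shadow H (setOf rest)
  rest-shadow = block v k′ r , edges k′ (n<1+n k′) , v k′ , x∈p∪q⁺ (inj₁ (x∈⁅x⁆ (v k′))) , (begin
    setOf rest                              ≡⟨ setOf-block v k (suc q) ⟩
    block v k (suc q)                       ≡⟨ sym (insert-remove (v k′) (block v k (suc q)) fresh) ⟩
    (⁅ v k′ ⁆ ∪ block v k (suc q)) - v k′   ∎)
    where
    open ≡-Reasoning
    fresh : v k′ ∉ˢ block v k (suc q)
    fresh v∈ with ∈-applyUpTo⁻ (λ t → v (k + t)) (setOf⁻ rest (subst (v k′ ∈ˢ_) (sym (setOf-block v k (suc q))) v∈))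
    ... | t , t<1+q , v≡ = <-irrefl (distinct k′ (k + t) (m<m+n k′ (s≤s z≤n)) (in-window (≤-pred t<1+q)) v≡)
                                     (s≤s (m≤m+n k′ t))

∈-─ : ∀ {A : Set} {y z : A} (ys : List A) (y∈ys : y ∈ ys) → z ∈ ys → z ≢ y → z ∈ (ys Any.─ y∈ys)
∈-─ (_ ∷ _)  (here refl)  (here refl)  z≢y = ⊥-elim (z≢y refl)
∈-─ (_ ∷ _)  (here refl)  (there z∈ys) _   = z∈ys
∈-─ (_ ∷ _)  (there y∈ys) (here refl)  _   = here refl
∈-─ (_ ∷ ys) (there y∈ys) (there z∈ys) z≢y = there (∈-─ ys y∈ys z∈ys z≢y)

injection-length : ∀ {A B : Set} (f : A → B) (xs : List A) (ys : List B) → Unique xs →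
  (∀ {x} → x ∈ xs → f x ∈ ys) → (∀ {x x′} → x ∈ xs → x′ ∈ xs → f x ≡ f x′ → x ≡ x′) →
  length xs ≤ length ys
injection-length f []       ys _            _    _   = z≤n
injection-length f (x ∷ xs) ys (x∉xs ∷ xs!) into inj = begin
  suc (length xs)                 ≤⟨ s≤s (injection-length f xs (ys Any.─ fx∈ys) xs! into′ (λ p q → inj (there p) (there q))) ⟩
  suc (length (ys Any.─ fx∈ys))   ≡⟨ sym (length-removeAt′ ys (Any.index fx∈ys)) ⟩
  length ys                       ∎
  where
  open ≤-Reasoning
  fx∈ys : f x ∈ ys
  fx∈ys = into (here refl)
  into′ : ∀ {x′} → x′ ∈ xs → f x′ ∈ (ys Any.─ fx∈ys)
  into′ {x′} x′∈xs = ∈-─ ys fx∈ys (into (there x′∈xs))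
    (λ fx′≡fx → All-lookup x∉xs x′∈xs (inj (here refl) (there x′∈xs) (sym fx′≡fx)))

elements : ∀ {n} → Subset n → List (Fin n)
elements []            = []
elements (inside ∷ p)  = zero ∷ map suc (elements p)
elements (outside ∷ p) = map suc (elements p)

elements-length : ∀ {n} (p : Subset n) → length (elements p) ≡ ∣ p ∣
elements-length []            = refl
elements-length (inside ∷ p)  = cong suc (trans (length-map suc (elements p)) (elements-length p))
elements-length (outside ∷ p) = trans (length-map suc (elements p)) (elements-length p)

elements⁺ : ∀ {n} {x : Fin n} (p : Subset n) → x ∈ˢ p → x ∈ elements p
elements⁺ (inside ∷ p)  Vec.here        = here refl
elements⁺ (inside ∷ p)  (Vec.there x∈p) = there (∈-map⁺ suc (elements⁺ p x∈p))
elements⁺ (outside ∷ p) (Vec.there x∈p) = ∈-map⁺ suc (elements⁺ p x∈p)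

candidates : ∀ {n} → List (Subset n) → List (Maybe (Fin n) × Subset n)
candidates []      = []
candidates (s ∷ M) = map (λ x → just x , s) (elements s) ++ candidates M

candidates⁺ : ∀ {n} {x : Fin n} {s} M → s ∈ M → x ∈ˢ s → (just x , s) ∈ candidates M
candidates⁺ (s ∷ M) (here refl) x∈s = ∈-++⁺ˡ (∈-map⁺ (λ x → just x , s) (elements⁺ s x∈s))
candidates⁺ (_ ∷ M) (there s∈M) x∈s = ∈-++⁺ʳ _ (candidates⁺ M s∈M x∈s)

candidates-length : ∀ {n c} (M : List (Subset n)) → (∀ {s} → s ∈ M → ∣ s ∣ ≤ c) →
                    length (candidates M) ≤ c * length M
candidates-length         []      _     = z≤n
candidates-length {c = c} (s ∷ M) small = begin
  length (pairs ++ candidates M)        ≡⟨ length-++ pairs ⟩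
  length pairs + length (candidates M)  ≡⟨ cong (_+ length (candidates M)) (trans (length-map _ (elements s)) (elements-length s)) ⟩
  ∣ s ∣ + length (candidates M)         ≤⟨ +-mono-≤ (small (here refl)) (candidates-length M (small ∘ there)) ⟩
  c + c * length M                      ≡⟨ sym (*-suc c (length M)) ⟩
  c * suc (length M)                    ∎
  where
  open ≤-Reasoning
  pairs : List (Maybe (Fin _) × Subset _)
  pairs = map (λ x → just x , s) (elements s)

shadow-size : ∀ {n r} {H : CGH n} {s} → Uniform r H → Shadow H s → ∣ s ∣ < r
shadow-size U (e , e∈H , x , x∈e , refl) = subst (∣ e - x ∣ <_) (U e e∈H) (x∈p⇒∣p-x∣<∣p∣ x∈e)

module EndIntervals {n q k′ : ℕ} where

  r k : ℕ
  r = suc (suc q)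
  k = suc k′

  private
    last-index : k + r ∸ 2 ≡ k + q
    last-index = trans (cong (_∸ 1) (+-suc k′ (suc q))) (+-suc k′ q)

  odd-InI : ∀ (v : ℕ → Fin n) x → ¬ 2 ∣ k → InCyc (v k′) (v k) x → InI r k v x
  odd-InI v x odd x∈I = (λ _ → x∈I) , (λ even → ⊥-elim (odd even))

  even-InI : ∀ (v : ℕ → Fin n) x → 2 ∣ k → InCyc (v (k + q)) (v k′) x → InI r k v x
  even-InI v x even x∈I = (λ odd → ⊥-elim (odd even)) , (λ _ → subst (λ i → InCyc (v i) (v k′) x) (sym last-index) x∈I)

  starts-comparable : ∀ (v v′ : ℕ → Fin n) → v k′ ≢ v′ k′ → v k ≡ v′ k → v (k + q) ≡ v′ (k + q) →
                      InI r k v (v′ k′) ⊎ InI r k v′ (v k′)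
  starts-comparable v v′ p≢p′ same-first same-last with 2 ∣? k
  ... | no odd with arc-dichotomy (v k′) (v′ k′) (v k) p≢p′
  ...   | inj₁ p′∈I = inj₁ (odd-InI v (v′ k′) odd p′∈I)
  ...   | inj₂ p∈I′ = inj₂ (odd-InI v′ (v k′) odd (subst (λ c → InCyc (v′ k′) c (v k′)) same-first p∈I′))
  starts-comparable v v′ _ _ same-last | yes even with ≤-total (off (v (k + q)) (v′ k′)) (off (v (k + q)) (v k′))
  ...   | inj₁ p′∈I = inj₁ (even-InI v (v′ k′) even p′∈I)
  ...   | inj₂ p∈I′ = inj₂ (even-InI v′ (v k′) even (subst (λ u → InCyc u (v′ k′) (v k′)) same-last p∈I′))

module _ {n q k′ : ℕ} (H : CGH n) where
  open ZigzagEnd using (rest; end-split; rest-cycOrd; rest-shadow)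
  open EndIntervals {n} {q} {k′} using (r; k; starts-comparable)

  g-into-shadow : (w : List (Fin n)) → T r k H w → CycShadow H (g w)
  g-into-shadow .(end r k v) (v , Z , refl , _) =
    subst (CycShadow H ∘ g) (sym (end-split Z)) (rest-shadow Z , rest-cycOrd Z)

  -- Part 2: g is injective on T_k(H), since X = ∅ forbids the competing edge.
  g-injective : (w w′ : List (Fin n)) → T r k H w → T r k H w′ → g w ≡ g w′ → w ≡ w′
  g-injective .(end r k v) .(end r k v′) (v , Z , refl , X) (v′ , Z′ , refl , X′) same-g = begin
    end r k v        ≡⟨ end-split Z ⟩
    v k′ ∷ rest Z    ≡⟨ cong₂ _∷_ same-start same-rest ⟩
    v′ k′ ∷ rest Z′  ≡⟨ sym (end-split Z′) ⟩
    end r k v′       ∎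
    where
    open ≡-Reasoning
    same-rest : rest Z ≡ rest Z′
    same-rest = trans (cong g (sym (end-split Z))) (trans same-g (cong g (end-split Z′)))
    same-at : ∀ t → t < suc q → v (k + t) ≡ v′ (k + t)
    same-at = applyUpTo-injective (suc q) same-rest
    same-block : block v k (suc q) ≡ block v′ k (suc q)
    same-block = trans (sym (setOf-block v k (suc q))) (trans (cong setOf same-rest) (setOf-block v′ k (suc q)))
    same-start : v k′ ≡ v′ k′
    same-start with v k′ ≟ v′ k′
    ... | yes p≡p′ = p≡p′
    ... | no  p≢p′ with starts-comparable v v′ p≢p′
                          (subst (λ i → v i ≡ v′ i) (+-identityʳ k) (same-at 0 (s≤s z≤n))) (same-at q (n<1+n q))
    ...   | inj₁ p′∈I = ⊥-elim (X (v′ k′) p′∈I (p≢p′ ∘ sym)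
                          (subst (λ B → H (⁅ v′ k′ ⁆ ∪ B)) (sym same-block) (Zigzag.edges Z′ k′ (n<1+n k′))))
    ...   | inj₂ p∈I′ = ⊥-elim (X′ (v k′) p∈I′ p≢p′
                          (subst (λ B → H (⁅ v k′ ⁆ ∪ B)) same-block (Zigzag.edges Z k′ (n<1+n k′))))

  -- An end in T_k(H) is recorded by the first point and the point set of its
  -- g-image; by parts 1 and 2 and cycOrd-unique this record is faithful.
  signature : List (Fin n) → Maybe (Fin n) × Subset n
  signature w = head (g w) , setOf (g w)

  signature-injective : ∀ {w w′} → T r k H w → T r k H w′ → signature w ≡ signature w′ → w ≡ w′
  signature-injective {w} {w′} w∈T w′∈T same = g-injective w w′ w∈T w′∈T
    (cycOrd-unique (g w) (g w′) (proj₂ (g-into-shadow w w∈T)) (proj₂ (g-into-shadow w′ w′∈T))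
      (cong proj₁ same) (cong proj₂ same))

  signature-candidate : ∀ {w} M → (∀ s → Shadow H s → s ∈ M) → T r k H w → signature w ∈ candidates M
  signature-candidate M all-shadows (v , Z , refl , _) =
    subst (λ w → signature w ∈ candidates M) (sym (end-split Z))
      (candidates⁺ M (all-shadows _ (rest-shadow Z)) (setOf⁺ (rest Z) (here refl)))

  T-bound : Uniform r H → (L : List (List (Fin n))) (M : List (Subset n)) →
            Enumerates (T r k H) L → Enumerates (Shadow H) M → length L ≤ suc q * length M
  T-bound U L M (L! , L⊆T , _) (_ , M⊆∂H , ∂H⊆M) = begin
    length L              ≤⟨ injection-length signature L (candidates M) L!
                               (signature-candidate M ∂H⊆M ∘ L⊆T _)
                               (λ w∈L w′∈L → signature-injective (L⊆T _ w∈L) (L⊆T _ w′∈L)) ⟩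
    length (candidates M) ≤⟨ candidates-length M (λ s∈M → ≤-pred (shadow-size U (M⊆∂H _ s∈M))) ⟩
    suc q * length M      ∎
    where open ≤-Reasoning

-- The hypotheses r ≥ 2 and k ≥ 1 put r = q + 2 and k = k′ + 1 in the form
-- used above.
proposition2p6 : (n r k : ℕ) → 2 ≤ r → 2 ∣ r → 1 ≤ k →
    (H : CGH n) → Uniform r H →
    ((w : List (Fin n)) → T r k H w → CycShadow H (g w))
    × ((w w′ : List (Fin n)) → T r k H w → T r k H w′ → g w ≡ g w′ → w ≡ w′)
    × ((L : List (List (Fin n))) (M : List (Subset n)) →
         Enumerates (T r k H) L → Enumerates (Shadow H) M →
         length L ≤ (r ∸ 1) * length M)
proposition2p6 n (suc (suc q)) (suc k′) (s≤s (s≤s z≤n)) _ (s≤s z≤n) H U =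
  g-into-shadow H , g-injective H , T-bound H U
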